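{- Let $G=(V,E)$ be a simple graph, let $(F,M)$ be a valid partition of $G$ (with respect to $k$ colors), and let $H=(V,M)$ be its surplus graph. Let $(u,v)\in M$ have color $i$ and $(v,w)\in M$ have color $j\neq i$. Then at least one of the following applies: (1) We may swap the colors of $(u,v)$ and $(v,w)$ in $H$, i.e., set $M_i\leftarrow (M_i\setminus\{(u,v)\})\cup\{(v,w)\}$ and $M_j\leftarrow (M_j\setminus\{(v,w)\})\cup\{(u,v)\}$, such that $(F,M)$ is still valid. (2) We may assign color $j$ to $(u,v)$ in $H$ and insert $(v,w)$ into $F_i$, i.e., remove $(u,v)$ from $M_i$, set $M_j\leftarrow (M_j\setminus\{(v,w)\})\cup\{(u,v)\}$ and $F_i\leftarrow F_i\cup\{(v,w)\}$, such that $(F,M)$ is still valid. (3) Symmetrically to (2), we may assign color $i$ to $(v,w)$ in $H$ and insert $(u,v)$ into $F_j$ (removing $(v,w)$ from $M_j$ and $(u,v)$ from $M_i$, adding $(v,w)$ to $M_i$ and $(u,v)$ to $F_j$), such that $(F,M)$ is still valid. (4) We may insert $(v,w)$ into $F_i$ and $(u,v)$ into $F_j$ (removing both edges from $M$), such that $(F,M)$ is still valid. Furthermore, if there is an edge $(w,x)\in M$ of color $i$, then (2) or (4) applies.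
   Context: A pseudoforest is a graph in which each connected component contains at most one cycle. For a pseudoforest $(V,P)$, a $P$-matching is a set obtained by choosing exactly one edge on each cycle of $(V,P)$. A valid partition of $G=(V,E)$ with $k$ colors is a partition $E=F\,\dot\cup\, M$ with $F=F_1\dot\cup\cdots\dot\cup F_k$ and $M=M_1\dot\cup\cdots\dot\cup M_k$ such that each $F_i$ is a forest, $P_i=F_i\cup M_i$ is a pseudoforest, and $M_i$ is a $P_i$-matching, for $i=1,\dots,k$. Edges of $F_i$ and of $M_i$ are said to have color $i$. The surplus graph of $(F,M)$ is $H=(V,M)$. -}

module Defs where

open import Data.Nat using (ℕ; suc; _≤_)
open import Data.Fin using (Fin; inject₁; _≟_)
open import Data.Fin.Properties using ()
open import Data.Product using (Σ; ∃; _×_; _,_)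
open import Data.Sum using (_⊎_)
open import Data.Empty using (⊥)
open import Relation.Nullary using (¬_; yes; no)
open import Relation.Binary.PropositionalEquality using (_≡_; _≢_)
open import Function using (Injective)

-- Finite simple (undirected) graphs.
-- Vertices are Fin n, edges are Fin m; edge e has endpoints src e, tgt e
-- (the orientation carries no meaning).  Simple: no loops, no parallel edges.

Joins′ : ∀ {n m} → (Fin m → Fin n) → (Fin m → Fin n) → Fin m → Fin n → Fin n → Set
Joins′ s t e a b = (s e ≡ a × t e ≡ b) ⊎ (s e ≡ b × t e ≡ a)

record SimpleGraph : Set where
  field
    n m      : ℕ
    src tgt  : Fin m → Fin n
    loopless : ∀ e → src e ≢ tgt e
    noParallel : ∀ e e′ → Joins′ src tgt e′ (src e) (tgt e) → e ≡ e′

module _ (G : SimpleGraph) where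
  open SimpleGraph G

  Vertex : Set
  Vertex = Fin n

  Edge : Set
  Edge = Fin m

  Joins : Edge → Vertex → Vertex → Set
  Joins = Joins′ src tgt

  -- A set of edges (edge subgraph on the full vertex set V)
  EdgeSet : Set₁
  EdgeSet = Edge → Set

  record Cycle (S : EdgeSet) : Set where
    field
      len     : ℕ
      len≥3   : 3 ≤ len
      verts   : Fin (suc len) → Vertex
      edges   : Fin len → Edge
      closed  : verts (Data.Fin.fromℕ len) ≡ verts Data.Fin.zero
      distinct : Injective _≡_ _≡_ (λ (j : Fin len) → verts (inject₁ j))
      joins   : ∀ j → Joins (edges j) (verts (inject₁ j)) (verts (Data.Fin.suc j))
      inS     : ∀ j → S (edges j)

  OnCycle : {S : EdgeSet} → Cycle S → Edge → Set
  OnCycle C e = ∃ λ j → Cycle.edges C j ≡ e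

  VertexOnCycle : {S : EdgeSet} → Cycle S → Vertex → Set
  VertexOnCycle C a = ∃ λ j → Cycle.verts C j ≡ a

  SameCycle : {S : EdgeSet} → Cycle S → Cycle S → Set
  SameCycle C C′ = ∀ e → (OnCycle C e → OnCycle C′ e) × (OnCycle C′ e → OnCycle C e)

  data Reach (S : EdgeSet) : Vertex → Vertex → Set where
    here : ∀ {a} → Reach S a a
    step : ∀ {a b c} (e : Edge) → S e → Joins e a b → Reach S b c → Reach S a c

  Forest : EdgeSet → Set
  Forest S = ¬ Cycle S

  -- pseudoforest: every connected component contains at most one cycle
  Pseudoforest : EdgeSet → Set
  Pseudoforest S = (C C′ : Cycle S) (a b : Vertex) →
    VertexOnCycle C a → VertexOnCycle C′ b → Reach S a b → SameCycle C C′

  PMatching : EdgeSet → EdgeSet → Set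
  PMatching P M =
    (∀ e → M e → ∃ λ (C : Cycle P) → OnCycle C e) ×
    ((C : Cycle P) → ∃ λ e → OnCycle C e × M e × (∀ e′ → OnCycle C e′ → M e′ → e′ ≡ e))

  -- Partitions E = F ∪ M, F = ⋃ F_i, M = ⋃ M_i, encoded as an assignment of
  -- a colour and a part (F or M) to every edge (this makes all unions disjoint).

  data Part : Set where
    inF inM : Part

  Partition : ℕ → Set
  Partition k = Edge → Fin k × Part

  module _ {k : ℕ} (p : Partition k) where
    Fᵢ : Fin k → EdgeSet
    Fᵢ i e = p e ≡ (i , inF)

    Mᵢ : Fin k → EdgeSet
    Mᵢ i e = p e ≡ (i , inM)

    Pᵢ : Fin k → EdgeSet
    Pᵢ i e = Fᵢ i e ⊎ Mᵢ i e

    Valid : Set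
    Valid = ∀ i → Forest (Fᵢ i) × Pseudoforest (Pᵢ i) × PMatching (Pᵢ i) (Mᵢ i)

  update₂ : ∀ {k} → Partition k → Edge → Fin k × Part → Edge → Fin k × Part → Partition k
  update₂ p e₁ c₁ e₂ c₂ e with e ≟ e₁
  ... | yes _ = c₁
  ... | no _ with e ≟ e₂
  ...   | yes _ = c₂
  ...   | no _ = p e

-- Each colour is handled separately.  In colour i, removing e₁ from Mᵢ destroys the
-- unique cycle of its component of Pᵢ, which thereby becomes a tree.  If v and w are
-- now disconnected in Pᵢ − e₁, then (v,w) is a bridge and can join Fᵢ; otherwise it
-- closes exactly one cycle, inside that tree component, and can be its matched edge.
-- Colour j is treated symmetrically with (u,v), and the four combinations are (1)–(4).
-- If w is an endpoint of some e₃ ∈ Mᵢ, then w lies on a cycle of Pᵢ; were v and w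
-- connected in Pᵢ − e₁, that cycle would be the one through e₁, forcing e₃ = e₁, which
-- is impossible, so colour i always takes the bridge case: (2) or (4).
module Submission where

open import Defs
open import Data.Nat using (ℕ; zero; suc; _≤_; _<_; z≤n; s≤s; s≤s⁻¹)
open import Data.Nat.Properties as ℕ using ()
open import Data.Fin using (Fin; toℕ; inject₁; fromℕ; fromℕ<; _≟_)
open import Data.Fin.Properties
  using (toℕ-injective; toℕ-fromℕ<; toℕ-inject₁; toℕ-fromℕ; toℕ<n; fromℕ<-toℕ; fromℕ≢inject₁; inject₁-injective; any?)
open import Data.Product as Product using (Σ; ∃; _×_; _,_; proj₁; proj₂)
open import Data.Product.Properties using (≡-dec)
open import Data.Sum as Sum using (_⊎_; inj₁; inj₂)
open import Data.Empty using (⊥; ⊥-elim)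
open import Data.Unit using (⊤; tt)
open import Data.List using (List; []; _∷_)
open import Data.List.Relation.Unary.Any using (here; there)
open import Data.List.Membership.Propositional using (_∈_; _∉_)
open import Function using (_∘_; id; Injective)
open import Relation.Nullary using (¬_; Dec; yes; no)
open import Relation.Nullary.Decidable using (map′; _⊎-dec_; _×-dec_)
open import Relation.Unary using (Decidable; _⊆_; _≐_; _∪_; _∖_; ｛_｝)
open import Relation.Unary.Properties using (_∩?_; ∁?)
open import Relation.Binary.Definitions using (DecidableEquality)
open import Relation.Binary.PropositionalEquality using (_≡_; _≢_; refl; sym; trans; cong; subst; subst₂)

module Paths (G : SimpleGraph) where
  open SimpleGraph G

  Joins-sym : ∀ {e a b} → Joins G e a b → Joins G e b a
  Joins-sym = Sum.swap

  Joins-endpoints : ∀ e → Joins G e (src e) (tgt e)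
  Joins-endpoints e = inj₁ (refl , refl)

  Joins-unique : ∀ {e a b c d} → Joins G e a b → Joins G e c d → (a ≡ c × b ≡ d) ⊎ (a ≡ d × b ≡ c)
  Joins-unique (inj₁ (refl , refl)) (inj₁ (refl , refl)) = inj₁ (refl , refl)
  Joins-unique (inj₁ (refl , refl)) (inj₂ (refl , refl)) = inj₂ (refl , refl)
  Joins-unique (inj₂ (refl , refl)) (inj₁ (refl , refl)) = inj₂ (refl , refl)
  Joins-unique (inj₂ (refl , refl)) (inj₂ (refl , refl)) = inj₁ (refl , refl)

  Joins-irrefl : ∀ {e a} → ¬ Joins G e a a
  Joins-irrefl {e} (inj₁ (refl , q)) = loopless e (sym q)
  Joins-irrefl {e} (inj₂ (refl , q)) = loopless e (sym q)

  Joins-injective : ∀ {e e′ a b} → Joins G e a b → Joins G e′ a b → e ≡ e′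
  Joins-injective {e} (inj₁ (refl , refl)) j′ = noParallel e _ j′
  Joins-injective {e} (inj₂ (refl , refl)) j′ = noParallel e _ (Joins-sym j′)

  module _ {S : EdgeSet G} where

    Reach-trans : ∀ {a b c} → Reach G S a b → Reach G S b c → Reach G S a c
    Reach-trans here r = r
    Reach-trans (step e Se j r) r′ = step e Se j (Reach-trans r r′)

    Reach-sym : ∀ {a b} → Reach G S a b → Reach G S b a
    Reach-sym here = here
    Reach-sym (step e Se j r) = Reach-trans (Reach-sym r) (step e Se (Joins-sym j) here)

    Reach-edge : ∀ {e a b} → S e → Joins G e a b → Reach G S a b
    Reach-edge Se j = step _ Se j here

  Reach-endpoints : ∀ {S e a b} → Joins G e a b → Reach G S a b → Reach G S (src e) (tgt e)
  Reach-endpoints (inj₁ (refl , refl)) r = r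
  Reach-endpoints (inj₂ (refl , refl)) r = Reach-sym r

  Reach-mono : ∀ {S T a b} → S ⊆ T → Reach G S a b → Reach G T a b
  Reach-mono S⊆T here = here
  Reach-mono S⊆T (step e Se j r) = step e (S⊆T Se) j (Reach-mono S⊆T r)

  ReachVia : EdgeSet G → Edge G → Vertex G → Vertex G → Set
  ReachVia S e a b = (Reach G S a (src e) × Reach G S (tgt e) b) ⊎ (Reach G S a (tgt e) × Reach G S (src e) b)

  ReachVia⇒Reach : ∀ {S e a b} → ReachVia S e a b → Reach G (S ∪ ｛ e ｝) a b
  ReachVia⇒Reach {e = e} (inj₁ (r , r′)) =
    Reach-trans (Reach-mono inj₁ r) (step e (inj₂ refl) (Joins-endpoints e) (Reach-mono inj₁ r′))
  ReachVia⇒Reach {e = e} (inj₂ (r , r′)) =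
    Reach-trans (Reach-mono inj₁ r) (step e (inj₂ refl) (Joins-sym (Joins-endpoints e)) (Reach-mono inj₁ r′))

  ReachVia-endpoint : ∀ {S e a b c d} → Joins G e c d → ReachVia S e a b → Reach G S a c ⊎ Reach G S c b
  ReachVia-endpoint (inj₁ (refl , _)) (inj₁ (r , _)) = inj₁ r
  ReachVia-endpoint (inj₁ (refl , _)) (inj₂ (_ , r)) = inj₂ r
  ReachVia-endpoint (inj₂ (_ , refl)) (inj₁ (_ , r)) = inj₂ r
  ReachVia-endpoint (inj₂ (_ , refl)) (inj₂ (r , _)) = inj₁ r

  Reach-∪-split : ∀ {S e a b} → Reach G (S ∪ ｛ e ｝) a b → Reach G S a b ⊎ ReachVia S e a b
  Reach-∪-split here = inj₁ here
  Reach-∪-split (step g (inj₁ Sg) j r) =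
    Sum.map (step g Sg j) (Sum.map (Product.map₁ (step g Sg j)) (Product.map₁ (step g Sg j))) (Reach-∪-split r)
  Reach-∪-split (step _ (inj₂ refl) (inj₁ (refl , refl)) r) with Reach-∪-split r
  ... | inj₁ r′ = inj₂ (inj₁ (here , r′))
  ... | inj₂ (inj₁ (_ , r′)) = inj₂ (inj₁ (here , r′))
  ... | inj₂ (inj₂ (_ , r′)) = inj₁ r′
  Reach-∪-split (step _ (inj₂ refl) (inj₂ (refl , refl)) r) with Reach-∪-split r
  ... | inj₁ r′ = inj₂ (inj₂ (here , r′))
  ... | inj₂ (inj₁ (_ , r′)) = inj₁ r′
  ... | inj₂ (inj₂ (_ , r′)) = inj₂ (inj₂ (here , r′))

  Reach-absorb : ∀ {S e a b} → Reach G S (src e) (tgt e) → Reach G (S ∪ ｛ e ｝) a b → Reach G S a b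
  Reach-absorb r r′ with Reach-∪-split r′
  ... | inj₁ r″ = r″
  ... | inj₂ (inj₁ (r₁ , r₂)) = Reach-trans r₁ (Reach-trans r r₂)
  ... | inj₂ (inj₂ (r₁ , r₂)) = Reach-trans r₁ (Reach-trans (Reach-sym r) r₂)

last-or-inject₁ : ∀ {n} (i : Fin (suc n)) → i ≡ fromℕ n ⊎ ∃ λ i′ → inject₁ i′ ≡ i
last-or-inject₁ {zero} Fin.zero = inj₁ refl
last-or-inject₁ {suc n} Fin.zero = inj₂ (Fin.zero , refl)
last-or-inject₁ {suc n} (Fin.suc i) =
  Sum.map (cong Fin.suc) (Product.map Fin.suc (cong Fin.suc)) (last-or-inject₁ i)

SameModulo : ℕ → ℕ → ℕ → Set
SameModulo n x y = x ≡ y ⊎ (x ≡ 0 × y ≡ n) ⊎ (x ≡ n × y ≡ 0)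

closed-collision : ∀ {A : Set} {n} (f : Fin (suc n) → A) → f (fromℕ n) ≡ f Fin.zero →
  Injective _≡_ _≡_ (f ∘ inject₁) → ∀ {i j} → f i ≡ f j → SameModulo n (toℕ i) (toℕ j)
closed-collision {n = zero} f _ _ {Fin.zero} {Fin.zero} _ = inj₁ refl
closed-collision {n = suc n} f closed distinct {i} {j} fi≡fj with last-or-inject₁ i | last-or-inject₁ j
... | inj₁ refl | inj₁ refl = inj₁ refl
... | inj₁ refl | inj₂ (j′ , refl) =
  inj₂ (inj₂ (toℕ-fromℕ _ , trans (toℕ-inject₁ j′) (cong toℕ (sym (distinct (trans (sym closed) fi≡fj))))))
... | inj₂ (i′ , refl) | inj₁ refl =
  inj₂ (inj₁ (trans (toℕ-inject₁ i′) (cong toℕ (distinct (trans fi≡fj closed))) , toℕ-fromℕ _))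
... | inj₂ (i′ , refl) | inj₂ (j′ , refl) = inj₁ (cong (toℕ ∘ inject₁) (distinct fi≡fj))

no-transposition : ∀ {n a b} → 3 ≤ n → SameModulo n a (suc b) → SameModulo n (suc a) b → ⊥
no-transposition _ (inj₁ refl) (inj₁ eq) = ℕ.m≢1+n+m _ (sym eq)
no-transposition (s≤s (s≤s ())) (inj₁ refl) (inj₂ (inj₂ (refl , refl)))
no-transposition (s≤s (s≤s ())) (inj₂ (inj₁ (refl , refl))) (inj₁ refl)
no-transposition _ (inj₂ (inj₂ (_ , ()))) _
no-transposition _ _ (inj₂ (inj₁ (() , _)))

module Cycles (G : SimpleGraph) where
  open Paths G

  OnCycle⊆ : ∀ {S} (C : Cycle G S) → OnCycle G C ⊆ S
  OnCycle⊆ C (j , refl) = Cycle.inS C j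

  restrict : ∀ {S T} (C : Cycle G S) → OnCycle G C ⊆ T → Cycle G T
  restrict C OnC⊆T = record
    { len = len ; len≥3 = len≥3 ; verts = verts ; edges = edges ; closed = closed
    ; distinct = distinct ; joins = joins ; inS = λ j → OnC⊆T (j , refl) }
    where open Cycle C

  Cycle-mono : ∀ {S T} → S ⊆ T → Cycle G S → Cycle G T
  Cycle-mono S⊆T C = restrict C (λ onC → S⊆T (OnCycle⊆ C onC))

  module _ {S : EdgeSet G} (C : Cycle G S) where
    open Cycle C renaming (len to L)

    edges-injective : ∀ {s t} → edges s ≡ edges t → s ≡ t
    edges-injective {s} {t} eq with Joins-unique (subst (λ g → Joins G g _ _) eq (joins s)) (joins t)
    ... | inj₁ (same , _) = distinct same
    ... | inj₂ (crossed₁ , crossed₂) = ⊥-elim (no-transposition len≥3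
      (subst (λ x → SameModulo L x _) (toℕ-inject₁ s) (closed-collision verts closed distinct crossed₁))
      (subst (SameModulo L _) (toℕ-inject₁ t) (closed-collision verts closed distinct crossed₂)))

    endpoints-on-cycle : ∀ {e a b} → OnCycle G C e → Joins G e a b → VertexOnCycle G C a × VertexOnCycle G C b
    endpoints-on-cycle (t , refl) j with Joins-unique (joins t) j
    ... | inj₁ (p , q) = (inject₁ t , p) , (Fin.suc t , q)
    ... | inj₂ (p , q) = (Fin.suc t , q) , (inject₁ t , p)

    private
      Arc : ℕ → ℕ → EdgeSet G
      Arc lo hi g = ∃ λ s → lo ≤ toℕ s × toℕ s < hi × edges s ≡ g

      vertex : (k : ℕ) → .(k < suc L) → Vertex G
      vertex k k≤L = verts (fromℕ< k≤L)

      verts-cong : ∀ {i j} → toℕ i ≡ toℕ j → verts i ≡ verts j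
      verts-cong = cong verts ∘ toℕ-injective

      arc-walk : ∀ {lo} hi .(lo≤L : lo < suc L) .(hi≤L : hi < suc L) → lo ≤ hi →
        Reach G (Arc lo hi) (vertex lo lo≤L) (vertex hi hi≤L)
      arc-walk zero _ _ z≤n = here
      arc-walk {lo} (suc h) lo≤L h<L lo≤1+h with ℕ.m≤n⇒m<n∨m≡n lo≤1+h
      ... | inj₂ refl = here
      ... | inj₁ lo≤h = Reach-trans (Reach-mono widen (arc-walk h lo≤L (ℕ.<⇒≤ h<L) (s≤s⁻¹ lo≤h)))
                                    (Reach-edge last (subst (λ x → Joins G (edges s) x (verts (Fin.suc s)))
                                                            (verts-cong toℕ-s) (joins s)))
        where
        s : Fin L
        s = fromℕ< (s≤s⁻¹ h<L)
        toℕ-s : toℕ (inject₁ s) ≡ toℕ (fromℕ< {h} {suc L} (ℕ.<⇒≤ h<L))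
        toℕ-s = trans (toℕ-inject₁ s) (trans (toℕ-fromℕ< _) (sym (toℕ-fromℕ< _)))
        widen : Arc lo h ⊆ Arc lo (suc h)
        widen (s′ , lo≤s′ , s′<h , refl) = s′ , lo≤s′ , ℕ.m<n⇒m<1+n s′<h , refl
        last : Arc lo (suc h) (edges s)
        last = s , subst (lo ≤_) (sym (toℕ-fromℕ< _)) (s≤s⁻¹ lo≤h) , s≤s (ℕ.≤-reflexive (toℕ-fromℕ< _)) , refl

      Arc⊆OnCycle : ∀ {lo hi} → Arc lo hi ⊆ OnCycle G C
      Arc⊆OnCycle (s , _ , _ , s≡g) = s , s≡g

      from-start : (i : Fin (suc L)) → Reach G (OnCycle G C) (verts Fin.zero) (verts i)
      from-start i = subst (Reach G _ _) (cong verts (fromℕ<-toℕ i (toℕ<n i)))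
                           (Reach-mono Arc⊆OnCycle (arc-walk (toℕ i) (s≤s z≤n) (toℕ<n i) z≤n))

      around : (t : Fin L) → Reach G (OnCycle G C ∖ ｛ edges t ｝) (verts (Fin.suc t)) (verts (inject₁ t))
      around t = subst₂ (Reach G _) start end
        (Reach-trans (Reach-mono after (arc-walk L (s≤s (toℕ<n t)) ℕ.≤-refl (toℕ<n t)))
                     (subst (λ x → Reach G (OnCycle G C ∖ ｛ edges t ｝) x (vertex (toℕ t) t≤L)) (sym wrap)
                            (Reach-mono before (arc-walk (toℕ t) (s≤s z≤n) t≤L z≤n))))
        where
        t≤L : toℕ t < suc L
        t≤L = ℕ.m<n⇒m<1+n (toℕ<n t)
        start : vertex (suc (toℕ t)) (s≤s (toℕ<n t)) ≡ verts (Fin.suc t)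
        start = verts-cong (toℕ-fromℕ< (s≤s (toℕ<n t)))
        end : vertex (toℕ t) t≤L ≡ verts (inject₁ t)
        end = verts-cong (trans (toℕ-fromℕ< t≤L) (sym (toℕ-inject₁ t)))
        wrap : vertex L ℕ.≤-refl ≡ verts Fin.zero
        wrap = trans (verts-cong (trans (toℕ-fromℕ< {L} {suc L} ℕ.≤-refl) (sym (toℕ-fromℕ L)))) closed
        after : Arc (suc (toℕ t)) L ⊆ OnCycle G C ∖ ｛ edges t ｝
        after (s , t<s , _ , refl) = (s , refl) , λ eq → ℕ.<-irrefl (cong toℕ (edges-injective eq)) t<s
        before : Arc 0 (toℕ t) ⊆ OnCycle G C ∖ ｛ edges t ｝
        before (s , _ , s<t , refl) = (s , refl) , λ eq → ℕ.<-irrefl (cong toℕ (edges-injective (sym eq))) s<t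

    cycle-connected : ∀ {a b} → VertexOnCycle G C a → VertexOnCycle G C b → Reach G (OnCycle G C) a b
    cycle-connected (i , refl) (j , refl) = Reach-trans (Reach-sym (from-start i)) (from-start j)

    cycle-minus-edge : ∀ {e a b} → OnCycle G C e → Joins G e a b → Reach G (OnCycle G C ∖ ｛ e ｝) a b
    cycle-minus-edge (t , refl) j with Joins-unique (joins t) j
    ... | inj₁ (refl , refl) = Reach-sym (around t)
    ... | inj₂ (refl , refl) = around t

module SimpleWalks (G : SimpleGraph) where
  open SimpleGraph G
  open Paths G
  open import Data.List.Membership.DecPropositional (_≟_ {n}) using (_∈?_)

  module _ {T : EdgeSet G} where

    visited : ∀ {a c} → Reach G T a c → List (Vertex G)
    visited {a} here = a ∷ []
    visited {a} (step _ _ _ r) = a ∷ visited r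

    Simple : ∀ {a c} → Reach G T a c → Set
    Simple here = ⊤
    Simple {a} (step _ _ _ r) = a ∉ visited r × Simple r

    suffix : ∀ {x b c} (r : Reach G T b c) → Simple r → x ∈ visited r → Σ (Reach G T x c) Simple
    suffix here simple (here refl) = here , tt
    suffix (step e Te j r) simple (here refl) = step e Te j r , simple
    suffix (step _ _ _ r) (_ , simple) (there x∈r) = suffix r simple x∈r

    simplify : ∀ {a c} → Reach G T a c → Σ (Reach G T a c) Simple
    simplify here = here , tt
    simplify {a} (step e Te j r) with simplify r
    ... | r′ , simple with a ∈? visited r′
    ...   | yes a∈r′ = suffix r′ simple a∈r′
    ...   | no a∉r′ = step e Te j r′ , a∉r′ , simple

    steps : ∀ {a c} → Reach G T a c → ℕ
    steps here = 0
    steps (step _ _ _ r) = suc (steps r)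

    vertexAt : ∀ {a c} (r : Reach G T a c) → Fin (suc (steps r)) → Vertex G
    vertexAt {a} here _ = a
    vertexAt {a} (step _ _ _ r) Fin.zero = a
    vertexAt (step _ _ _ r) (Fin.suc k) = vertexAt r k

    edgeAt : ∀ {a c} (r : Reach G T a c) → Fin (steps r) → Edge G
    edgeAt (step e _ _ r) Fin.zero = e
    edgeAt (step _ _ _ r) (Fin.suc k) = edgeAt r k

    vertexAt-zero : ∀ {a c} (r : Reach G T a c) → vertexAt r Fin.zero ≡ a
    vertexAt-zero here = refl
    vertexAt-zero (step _ _ _ r) = refl

    vertexAt-last : ∀ {a c} (r : Reach G T a c) → vertexAt r (fromℕ (steps r)) ≡ c
    vertexAt-last here = refl
    vertexAt-last (step _ _ _ r) = vertexAt-last r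

    edgeAt-joins : ∀ {a c} (r : Reach G T a c) k →
      Joins G (edgeAt r k) (vertexAt r (inject₁ k)) (vertexAt r (Fin.suc k))
    edgeAt-joins (step e _ j r) Fin.zero = subst (Joins G e _) (sym (vertexAt-zero r)) j
    edgeAt-joins (step _ _ _ r) (Fin.suc k) = edgeAt-joins r k

    edgeAt-∈ : ∀ {a c} (r : Reach G T a c) k → T (edgeAt r k)
    edgeAt-∈ (step _ Te _ r) Fin.zero = Te
    edgeAt-∈ (step _ _ _ r) (Fin.suc k) = edgeAt-∈ r k

    vertexAt-visited : ∀ {a c} (r : Reach G T a c) k → vertexAt r k ∈ visited r
    vertexAt-visited here Fin.zero = here refl
    vertexAt-visited (step _ _ _ r) Fin.zero = here refl
    vertexAt-visited (step _ _ _ r) (Fin.suc k) = there (vertexAt-visited r k)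

    vertexAt-injective : ∀ {a c} (r : Reach G T a c) → Simple r → Injective _≡_ _≡_ (vertexAt r)
    vertexAt-injective here _ {Fin.zero} {Fin.zero} _ = refl
    vertexAt-injective (step _ _ _ r) _ {Fin.zero} {Fin.zero} _ = refl
    vertexAt-injective (step _ _ _ r) (a∉r , _) {Fin.zero} {Fin.suc k′} eq =
      ⊥-elim (a∉r (subst (_∈ visited r) (sym eq) (vertexAt-visited r k′)))
    vertexAt-injective (step _ _ _ r) (a∉r , _) {Fin.suc k} {Fin.zero} eq =
      ⊥-elim (a∉r (subst (_∈ visited r) eq (vertexAt-visited r k)))
    vertexAt-injective (step _ _ _ r) (_ , simple) {Fin.suc k} {Fin.suc k′} eq =
      cong Fin.suc (vertexAt-injective r simple eq)

    steps≥2 : ∀ {a c} (r : Reach G T a c) → a ≢ c → (∀ {g} → T g → ¬ Joins G g a c) → 2 ≤ steps r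
    steps≥2 here a≢c _ = ⊥-elim (a≢c refl)
    steps≥2 (step _ Te j here) _ nonadjacent = ⊥-elim (nonadjacent Te j)
    steps≥2 (step _ _ _ (step _ _ _ _)) _ _ = s≤s (s≤s z≤n)

  simple-cycle-through : ∀ {S f} → S f → (r : Reach G (S ∖ ｛ f ｝) (tgt f) (src f)) → Simple r →
    Σ (Cycle G S) λ C → OnCycle G C f
  simple-cycle-through {S} {f} Sf r simple = C , Fin.zero , refl
    where
    vs : Fin (suc (suc (steps r))) → Vertex G
    vs Fin.zero = src f
    vs (Fin.suc k) = vertexAt r k
    es : Fin (suc (steps r)) → Edge G
    es Fin.zero = f
    es (Fin.suc k) = edgeAt r k
    no-parallel : ∀ {g} → (S ∖ ｛ f ｝) g → ¬ Joins G g (tgt f) (src f)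
    no-parallel (_ , f≢g) j = f≢g (Joins-injective (Joins-endpoints f) (Joins-sym j))
    distinct : Injective _≡_ _≡_ (vs ∘ inject₁)
    distinct {Fin.zero} {Fin.zero} _ = refl
    distinct {Fin.zero} {Fin.suc k} eq = ⊥-elim (fromℕ≢inject₁ (vertexAt-injective r simple (trans (vertexAt-last r) eq)))
    distinct {Fin.suc k} {Fin.zero} eq = ⊥-elim (fromℕ≢inject₁ (vertexAt-injective r simple (trans (vertexAt-last r) (sym eq))))
    distinct {Fin.suc k} {Fin.suc k′} eq = cong Fin.suc (inject₁-injective (vertexAt-injective r simple eq))
    joins : ∀ k → Joins G (es k) (vs (inject₁ k)) (vs (Fin.suc k))
    joins Fin.zero = subst (Joins G f (src f)) (sym (vertexAt-zero r)) (Joins-endpoints f)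
    joins (Fin.suc k) = edgeAt-joins r k
    inS : ∀ k → S (es k)
    inS Fin.zero = Sf
    inS (Fin.suc k) = proj₁ (edgeAt-∈ r k)
    C : Cycle G S
    C = record
      { len = suc (steps r) ; len≥3 = s≤s (steps≥2 r (λ eq → loopless f (sym eq)) no-parallel)
      ; verts = vs ; edges = es ; closed = vertexAt-last r ; distinct = distinct ; joins = joins ; inS = inS }

  cycle-through : ∀ {S f} → S f → Reach G (S ∖ ｛ f ｝) (tgt f) (src f) → Σ (Cycle G S) λ C → OnCycle G C f
  cycle-through Sf r = Product.uncurry (simple-cycle-through Sf) (simplify r)

module Decidability (G : SimpleGraph) where
  open SimpleGraph G
  open Paths G

  OnCycle-dec : ∀ {S} (C : Cycle G S) → Decidable (OnCycle G C)
  OnCycle-dec C e = any? λ j → Cycle.edges C j ≟ e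

  _≟ᴾ_ : DecidableEquality (Part G)
  inF ≟ᴾ inF = yes refl
  inF ≟ᴾ inM = no λ ()
  inM ≟ᴾ inF = no λ ()
  inM ≟ᴾ inM = yes refl

  Pᵢ-dec : ∀ {k} (p : Partition G k) c → Decidable (Pᵢ G p c)
  Pᵢ-dec {k} p c g = (p g ≟ₓ (c , inF)) ⊎-dec (p g ≟ₓ (c , inM))
    where
    _≟ₓ_ : DecidableEquality (Fin k × Part G)
    _≟ₓ_ = ≡-dec _≟_ _≟ᴾ_

  module _ {S : EdgeSet G} (S? : Decidable S) where

    -- Reachability is decided by admitting the edges of S one index at a time.
    Below : ℕ → EdgeSet G
    Below k g = S g × toℕ g < k

    Below-suc : ∀ {k} (k<m : k < m) → Below (suc k) ⊆ Below k ∪ ｛ fromℕ< k<m ｝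
    Below-suc k<m (Sg , g≤k) with ℕ.m≤n⇒m<n∨m≡n (s≤s⁻¹ g≤k)
    ... | inj₁ g<k = inj₁ (Sg , g<k)
    ... | inj₂ g≡k = inj₂ (toℕ-injective (trans (toℕ-fromℕ< k<m) (sym g≡k)))

    Reach-Below-dec : ∀ k → k ≤ m → ∀ a b → Dec (Reach G (Below k) a b)
    Reach-Below-dec zero _ a b with a ≟ b
    ... | yes refl = yes here
    ... | no a≢b = no λ { here → a≢b refl ; (step _ (_ , ()) _ _) }
    Reach-Below-dec (suc k) k<m a b with S? (fromℕ< k<m)
    ... | no ¬Se = map′ (Reach-mono widen) (Reach-mono shrink) (dec a b)
      where
      dec : ∀ a b → Dec (Reach G (Below k) a b)
      dec = Reach-Below-dec k (ℕ.<⇒≤ k<m)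
      widen : Below k ⊆ Below (suc k)
      widen (Sg , g<k) = Sg , ℕ.m<n⇒m<1+n g<k
      shrink : Below (suc k) ⊆ Below k
      shrink g∈ with Below-suc k<m g∈
      ... | inj₁ g∈′ = g∈′
      ... | inj₂ refl = ⊥-elim (¬Se (proj₁ g∈))
    ... | yes Se = map′ (Reach-mono extend ∘ Sum.[ Reach-mono inj₁ , ReachVia⇒Reach ])
                        (Reach-∪-split ∘ Reach-mono (Below-suc k<m))
                        (dec a b ⊎-dec ((dec a (src e) ×-dec dec (tgt e) b) ⊎-dec (dec a (tgt e) ×-dec dec (src e) b)))
      where
      e : Edge G
      e = fromℕ< k<m
      dec : ∀ a b → Dec (Reach G (Below k) a b)
      dec = Reach-Below-dec k (ℕ.<⇒≤ k<m)
      extend : Below k ∪ ｛ e ｝ ⊆ Below (suc k)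
      extend (inj₁ (Sg , g<k)) = Sg , ℕ.m<n⇒m<1+n g<k
      extend (inj₂ refl) = Se , s≤s (ℕ.≤-reflexive (toℕ-fromℕ< k<m))

    Reach-dec : ∀ a b → Dec (Reach G S a b)
    Reach-dec a b = map′ (Reach-mono proj₁) (Reach-mono λ Sg → Sg , toℕ<n _) (Reach-Below-dec m ℕ.≤-refl a b)

module Exchange (G : SimpleGraph) where
  open SimpleGraph G
  open Paths G
  open Cycles G
  open SimpleWalks G using (cycle-through)
  open Decidability G using (OnCycle-dec)

  ValidPair : EdgeSet G → EdgeSet G → Set
  ValidPair F M = Forest G F × Pseudoforest G (F ∪ M) × PMatching G (F ∪ M) M

  ValidPair-resp-≐ : ∀ {F M F′ M′} → F ≐ F′ → M ≐ M′ → ValidPair F M → ValidPair F′ M′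
  ValidPair-resp-≐ {F} {M} {F′} {M′} (F⊆F′ , F′⊆F) (M⊆M′ , M′⊆M) (forest , pseudo , cycles-matched , matching) =
    forest ∘ Cycle-mono F′⊆F ,
    (λ D D′ α β α∈D β∈D′ r →
       pseudo (Cycle-mono P′⊆P D) (Cycle-mono P′⊆P D′) α β α∈D β∈D′ (Reach-mono P′⊆P r)) ,
    (λ e M′e → let (C , e∈C) = cycles-matched e (M′⊆M M′e) in Cycle-mono P⊆P′ C , e∈C) ,
    λ D → let (e , e∈D , Me , unique) = matching (Cycle-mono P′⊆P D)
          in e , e∈D , M⊆M′ Me , λ e′ e′∈D M′e′ → unique e′ e′∈D (M′⊆M M′e′)
    where
    P⊆P′ : F ∪ M ⊆ F′ ∪ M′
    P⊆P′ = Sum.map F⊆F′ M⊆M′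
    P′⊆P : F′ ∪ M′ ⊆ F ∪ M
    P′⊆P = Sum.map F′⊆F M′⊆M

  matched-unique : ∀ {P M} → PMatching G P M → (C : Cycle G P) →
    ∀ {g g′} → OnCycle G C g → M g → OnCycle G C g′ → M g′ → g ≡ g′
  matched-unique (_ , matching) C g∈C Mg g′∈C Mg′ with matching C
  ... | _ , _ , _ , unique = trans (unique _ g∈C Mg) (sym (unique _ g′∈C Mg′))

  module _ {F M : EdgeSet G} (valid : ValidPair F M) {a b : Edge G} (Ma : M a) (a∉F : ¬ F a) (b∉F : ¬ F b) (b∉M : ¬ M b)
           {y x z : Vertex G} (a-yx : Joins G a y x) (b-yz : Joins G b y z) where

    private
      P R : EdgeSet G
      P = F ∪ M
      R = P ∖ ｛ a ｝

      pseudo : Pseudoforest G P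
      pseudo = proj₁ (proj₂ valid)

      matching : PMatching G P M
      matching = proj₂ (proj₂ valid)

      C₀ : Cycle G P
      C₀ = proj₁ (proj₁ matching a Ma)

      a∈C₀ : OnCycle G C₀ a
      a∈C₀ = proj₂ (proj₁ matching a Ma)

      y∈C₀ : VertexOnCycle G C₀ y
      y∈C₀ = proj₁ (endpoints-on-cycle C₀ a∈C₀ a-yx)

      R⊆P : R ⊆ P
      R⊆P = proj₁

      b∉P : ¬ P b
      b∉P = Sum.[ b∉F , b∉M ]

      F-avoids-a : ∀ {g} → F g → a ≢ g
      F-avoids-a Fg a≡g = a∉F (subst F (sym a≡g) Fg)

    -- The component of y in P contains C₀, its only cycle, and C₀ passes through a.
    no-R-cycle-reachable : (D : Cycle G R) → ∀ {α} → VertexOnCycle G D α → ¬ Reach G P y α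
    no-R-cycle-reachable D α∈D r =
      proj₂ (OnCycle⊆ D (proj₁ (pseudo C₀ (Cycle-mono R⊆P D) y _ y∈C₀ α∈D r a) a∈C₀)) refl

    matched-in-R : ∀ {g} → M g → a ≢ g → Σ (Cycle G R) λ C → OnCycle G C g
    matched-in-R {g} Mg a≢g =
      let (C , g∈C) = proj₁ matching g Mg
          a∉C : ∀ {h} → OnCycle G C h → a ≢ h
          a∉C h∈C a≡h = a≢g (matched-unique matching C (subst (OnCycle G C) (sym a≡h) h∈C) Ma g∈C Mg)
      in restrict C (λ h∈C → OnCycle⊆ C h∈C , a∉C h∈C) , g∈C

    avoiding : ∀ {P′} → P′ ⊆ R ∪ ｛ b ｝ → (D : Cycle G P′) → ¬ OnCycle G D b → Cycle G R
    avoiding P′⊆R+b D b∉D =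
      restrict D λ {h} h∈D → Sum.[ id , (λ { refl → ⊥-elim (b∉D h∈D) }) ] (P′⊆R+b (OnCycle⊆ D h∈D))

    matched-endpoint-separated : ∀ {e₃ t} → Joins G e₃ z t → M e₃ → ¬ Reach G R y z
    matched-endpoint-separated {e₃} z-t M₃ r with proj₁ matching e₃ M₃
    ... | C₃ , e₃∈C₃ with matched-unique matching C₃
          (proj₁ (pseudo C₀ C₃ y z y∈C₀ (proj₁ (endpoints-on-cycle C₃ e₃∈C₃ z-t)) (Reach-mono R⊆P r) a) a∈C₀)
          Ma e₃∈C₃ M₃
    ... | refl with Joins-unique a-yx z-t
    ...   | inj₁ (y≡z , _) = Joins-irrefl (subst (Joins G b y) (sym y≡z) b-yz)
    ...   | inj₂ (_ , x≡z) = b∉M (subst M (Joins-injective (subst (Joins G a y) x≡z a-yx) b-yz) Ma)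

    module _ (separated : ¬ Reach G R y z) where
      private
        F′ M′ P′ : EdgeSet G
        F′ = F ∪ ｛ b ｝
        M′ = M ∖ ｛ a ｝
        P′ = F′ ∪ M′

        P′⊆R+b : P′ ⊆ R ∪ ｛ b ｝
        P′⊆R+b (inj₁ (inj₁ Fg)) = inj₁ (inj₁ Fg , F-avoids-a Fg)
        P′⊆R+b (inj₁ (inj₂ b≡g)) = inj₂ b≡g
        P′⊆R+b (inj₂ (Mg , a≢g)) = inj₁ (inj₂ Mg , a≢g)

        R⊆P′ : R ⊆ P′
        R⊆P′ (inj₁ Fg , _) = inj₁ (inj₁ Fg)
        R⊆P′ (inj₂ Mg , a≢g) = inj₂ (Mg , a≢g)

        b-on-no-cycle : (D : Cycle G P′) → ¬ OnCycle G D b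
        b-on-no-cycle D b∈D = separated (Reach-mono into-R (cycle-minus-edge D b∈D b-yz))
          where
          into-R : OnCycle G D ∖ ｛ b ｝ ⊆ R
          into-R (g∈D , b≢g) = Sum.[ id , ⊥-elim ∘ b≢g ] (P′⊆R+b (OnCycle⊆ D g∈D))

        as-R-cycle : Cycle G P′ → Cycle G R
        as-R-cycle D = avoiding P′⊆R+b D (b-on-no-cycle D)

        forest′ : Forest G F′
        forest′ D = proj₁ valid (restrict D in-F)
          where
          in-F : OnCycle G D ⊆ F
          in-F g∈D with OnCycle⊆ D g∈D
          ... | inj₁ Fg = Fg
          ... | inj₂ refl = ⊥-elim (b-on-no-cycle (Cycle-mono inj₁ D) g∈D)

        pseudo′ : Pseudoforest G P′
        pseudo′ D D′ α β α∈D β∈D′ r with Reach-∪-split (Reach-mono (Sum.map₁ R⊆P ∘ P′⊆R+b) r)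
        ... | inj₁ r′ = pseudo (Cycle-mono R⊆P (as-R-cycle D)) (Cycle-mono R⊆P (as-R-cycle D′)) α β α∈D β∈D′ r′
        ... | inj₂ via = ⊥-elim (Sum.[ (λ α→y → no-R-cycle-reachable (as-R-cycle D) α∈D (Reach-sym α→y))
                                     , no-R-cycle-reachable (as-R-cycle D′) β∈D′ ] (ReachVia-endpoint b-yz via))

        matched′ : ∀ e → M′ e → ∃ λ (C : Cycle G P′) → OnCycle G C e
        matched′ e (Me , a≢e) = let (C , e∈C) = matched-in-R Me a≢e in Cycle-mono R⊆P′ C , e∈C

        matching′ : (D : Cycle G P′) →
          ∃ λ e → OnCycle G D e × M′ e × (∀ e′ → OnCycle G D e′ → M′ e′ → e′ ≡ e)
        matching′ D =
          let (e , e∈D , Me , unique) = proj₂ matching (Cycle-mono R⊆P (as-R-cycle D))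
          in e , e∈D , (Me , proj₂ (OnCycle⊆ (as-R-cycle D) e∈D)) ,
             λ e′ e′∈D M′e′ → unique e′ e′∈D (proj₁ M′e′)

      bridge-into-forest : ValidPair (F ∪ ｛ b ｝) (M ∖ ｛ a ｝)
      bridge-into-forest = forest′ , pseudo′ , matched′ , matching′

    module _ (closing : Reach G R y z) where
      private
        M′ P′ : EdgeSet G
        M′ = (M ∖ ｛ a ｝) ∪ ｛ b ｝
        P′ = F ∪ M′

        P′⊆R+b : P′ ⊆ R ∪ ｛ b ｝
        P′⊆R+b (inj₁ Fg) = inj₁ (inj₁ Fg , F-avoids-a Fg)
        P′⊆R+b (inj₂ (inj₁ (Mg , a≢g))) = inj₁ (inj₂ Mg , a≢g)
        P′⊆R+b (inj₂ (inj₂ b≡g)) = inj₂ b≡g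

        R⊆P′∖b : R ⊆ P′ ∖ ｛ b ｝
        R⊆P′∖b (Pg , a≢g) = Sum.map id (λ Mg → inj₁ (Mg , a≢g)) Pg , λ { refl → b∉P Pg }

        b-ends : Reach G R (src b) (tgt b)
        b-ends = Reach-endpoints b-yz closing

        collapse : ∀ {α β} → Reach G P′ α β → Reach G R α β
        collapse = Reach-absorb b-ends ∘ Reach-mono P′⊆R+b

        R-cycle-far : (D : Cycle G R) → ∀ {α} → VertexOnCycle G D α → ¬ Reach G P′ y α
        R-cycle-far D α∈D = no-R-cycle-reachable D α∈D ∘ Reach-mono R⊆P ∘ collapse

        from-y : (D : Cycle G P′) → OnCycle G D b → ∀ {γ} → VertexOnCycle G D γ → Reach G P′ y γ
        from-y D b∈D γ∈D = Reach-mono (OnCycle⊆ D) (cycle-connected D (proj₁ (endpoints-on-cycle D b∈D b-yz)) γ∈D)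

        matched′ : ∀ e → M′ e → ∃ λ (C : Cycle G P′) → OnCycle G C e
        matched′ e (inj₁ (Me , a≢e)) = let (C , e∈C) = matched-in-R Me a≢e in Cycle-mono (proj₁ ∘ R⊆P′∖b) C , e∈C
        matched′ e (inj₂ refl) = cycle-through (inj₂ (inj₂ refl)) (Reach-mono R⊆P′∖b (Reach-sym b-ends))

        matching′ : (D : Cycle G P′) →
          ∃ λ e → OnCycle G D e × M′ e × (∀ e′ → OnCycle G D e′ → M′ e′ → e′ ≡ e)
        matching′ D with OnCycle-dec D b
        ... | yes b∈D = b , b∈D , inj₂ refl , unique
          where
          unique : ∀ e′ → OnCycle G D e′ → M′ e′ → e′ ≡ b
          unique e′ e′∈D (inj₂ refl) = refl
          unique e′ e′∈D (inj₁ (Me′ , a≢e′)) =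
            let (E , e′∈E) = matched-in-R Me′ a≢e′
            in ⊥-elim (R-cycle-far E (proj₁ (endpoints-on-cycle E e′∈E (Joins-endpoints e′)))
                                     (from-y D b∈D (proj₁ (endpoints-on-cycle D e′∈D (Joins-endpoints e′)))))
        ... | no b∉D =
          let (e , e∈D , Me , unique) = proj₂ matching (Cycle-mono R⊆P (avoiding P′⊆R+b D b∉D))
          in e , e∈D , inj₁ (Me , proj₂ (OnCycle⊆ (avoiding P′⊆R+b D b∉D) e∈D)) , λ where
               e′ e′∈D (inj₁ (Me′ , _)) → unique e′ e′∈D Me′
               e′ e′∈D (inj₂ refl) → ⊥-elim (b∉D e′∈D)

        -- An edge f of D missing from D′ would be closed, by D − f and the b-free detour D′ − b,
        -- into a cycle through f avoiding b: a cycle of R next to y.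
        cycles-through-b-agree : (D D′ : Cycle G P′) → OnCycle G D b → OnCycle G D′ b → OnCycle G D ⊆ OnCycle G D′
        cycles-through-b-agree D D′ b∈D b∈D′ {f} f∈D with OnCycle-dec D′ f
        ... | yes f∈D′ = f∈D′
        ... | no f∉D′ = ⊥-elim (R-cycle-far E (proj₁ (endpoints-on-cycle E f∈E (Joins-endpoints f)))
                                               (from-y D b∈D (proj₁ (endpoints-on-cycle D f∈D (Joins-endpoints f)))))
          where
          Q : EdgeSet G
          Q = (P′ ∖ ｛ b ｝) ∖ ｛ f ｝
          b≢f : b ≢ f
          b≢f refl = f∉D′ b∈D′
          around-D′ : Reach G Q (src b) (tgt b)
          around-D′ = Reach-mono (λ (g∈D′ , b≢g) → (OnCycle⊆ D′ g∈D′ , b≢g) , λ { refl → f∉D′ g∈D′ })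
                                 (cycle-minus-edge D′ b∈D′ (Joins-endpoints b))
          around-D : Reach G (Q ∪ ｛ b ｝) (tgt f) (src f)
          around-D = Reach-mono into (cycle-minus-edge D f∈D (Joins-sym (Joins-endpoints f)))
            where
            into : OnCycle G D ∖ ｛ f ｝ ⊆ Q ∪ ｛ b ｝
            into {g} (g∈D , f≢g) with b ≟ g
            ... | yes b≡g = inj₂ b≡g
            ... | no b≢g = inj₁ ((OnCycle⊆ D g∈D , b≢g) , f≢g)
          through-f : Σ (Cycle G (P′ ∖ ｛ b ｝)) λ E → OnCycle G E f
          through-f = cycle-through (OnCycle⊆ D f∈D , b≢f) (Reach-absorb around-D′ around-D)
          E : Cycle G R
          E = Cycle-mono (λ (P′g , b≢g) → Sum.[ id , ⊥-elim ∘ b≢g ] (P′⊆R+b P′g)) (proj₁ through-f)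
          f∈E : OnCycle G E f
          f∈E = proj₂ through-f

        pseudo′ : Pseudoforest G P′
        pseudo′ D D′ α β α∈D β∈D′ r with OnCycle-dec D b | OnCycle-dec D′ b
        ... | no b∉D | no b∉D′ =
          pseudo (Cycle-mono R⊆P (avoiding P′⊆R+b D b∉D)) (Cycle-mono R⊆P (avoiding P′⊆R+b D′ b∉D′))
                 α β α∈D β∈D′ (Reach-mono R⊆P (collapse r))
        ... | yes b∈D | no b∉D′ =
          ⊥-elim (R-cycle-far (avoiding P′⊆R+b D′ b∉D′) β∈D′ (Reach-trans (from-y D b∈D α∈D) r))
        ... | no b∉D | yes b∈D′ =
          ⊥-elim (R-cycle-far (avoiding P′⊆R+b D b∉D) α∈D (Reach-trans (from-y D′ b∈D′ β∈D′) (Reach-sym r)))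
        ... | yes b∈D | yes b∈D′ =
          λ f → cycles-through-b-agree D D′ b∈D b∈D′ , cycles-through-b-agree D′ D b∈D′ b∈D

      cycle-closer-into-matching : ValidPair F ((M ∖ ｛ a ｝) ∪ ｛ b ｝)
      cycle-closer-into-matching = proj₁ valid , pseudo′ , matched′ , matching′

module Recolouring (G : SimpleGraph) {k : ℕ} where
  open Exchange G

  ValidColour : Partition G k → Fin k → Set
  ValidColour p c = ValidPair (Fᵢ G p c) (Mᵢ G p c)

  Recolours : (p q : Partition G k) → Fin k → Edge G → Edge G → Part G → Set
  Recolours p q c out new π =
    ∀ g → (out ≡ g × proj₁ (q g) ≢ c) ⊎ (new ≡ g × q g ≡ (c , π)) ⊎ (out ≢ g × new ≢ g × q g ≡ p g)

  update₂-view : ∀ (p : Partition G k) e₁ c₁ e₂ c₂ g →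
    (e₁ ≡ g × update₂ G p e₁ c₁ e₂ c₂ g ≡ c₁) ⊎
    (e₁ ≢ g × e₂ ≡ g × update₂ G p e₁ c₁ e₂ c₂ g ≡ c₂) ⊎
    (e₁ ≢ g × e₂ ≢ g × update₂ G p e₁ c₁ e₂ c₂ g ≡ p g)
  update₂-view p e₁ c₁ e₂ c₂ g with g ≟ e₁
  ... | yes g≡e₁ = inj₁ (sym g≡e₁ , refl)
  ... | no g≢e₁ with g ≟ e₂
  ...   | yes g≡e₂ = inj₂ (inj₁ (g≢e₁ ∘ sym , sym g≡e₂ , refl))
  ...   | no g≢e₂ = inj₂ (inj₂ (g≢e₁ ∘ sym , g≢e₂ ∘ sym , refl))

  module _ {p : Partition G k} {c : Fin k} {out new : Edge G} (out∈M : p out ≡ (c , inM)) (new∉c : proj₁ (p new) ≢ c) where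

    private
      kept : ∀ {q π g x} → Recolours p q c out new π → p g ≡ (c , x) → (out ≡ g × x ≡ inM) ⊎ q g ≡ (c , x)
      kept {g = g} recolours pg with recolours g
      ... | inj₁ (refl , _) = inj₁ (refl , cong proj₂ (trans (sym pg) out∈M))
      ... | inj₂ (inj₁ (refl , _)) = ⊥-elim (new∉c (cong proj₁ pg))
      ... | inj₂ (inj₂ (_ , _ , qg≡pg)) = inj₂ (trans qg≡pg pg)

      gained : ∀ {q π g x} → Recolours p q c out new π → q g ≡ (c , x) →
        (new ≡ g × π ≡ x) ⊎ (out ≢ g × p g ≡ (c , x))
      gained {g = g} recolours qg with recolours g
      ... | inj₁ (_ , qg≢c) = ⊥-elim (qg≢c (cong proj₁ qg))
      ... | inj₂ (inj₁ (new≡g , qg≡cπ)) = inj₁ (new≡g , cong proj₂ (trans (sym qg≡cπ) qg))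
      ... | inj₂ (inj₂ (out≢g , _ , qg≡pg)) = inj₂ (out≢g , trans (sym qg≡pg) qg)

      new-recoloured : ∀ {q π} → Recolours p q c out new π → q new ≡ (c , π)
      new-recoloured recolours with recolours new
      ... | inj₁ (out≡new , _) = ⊥-elim (new∉c (cong proj₁ (subst (λ e → p e ≡ (c , inM)) out≡new out∈M)))
      ... | inj₂ (inj₁ (_ , qnew)) = qnew
      ... | inj₂ (inj₂ (_ , new≢new , _)) = ⊥-elim (new≢new refl)

    forest-gains : ∀ {q} → Recolours p q c out new inF → Fᵢ G p c ∪ ｛ new ｝ ≐ Fᵢ G q c
    forest-gains {q} recolours = Sum.[ to , (λ { refl → new-recoloured recolours }) ] , from
      where
      to : ∀ {g} → Fᵢ G p c g → Fᵢ G q c g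
      to pg with kept recolours pg
      ... | inj₂ qg = qg
      from : ∀ {g} → Fᵢ G q c g → (Fᵢ G p c ∪ ｛ new ｝) g
      from qg with gained recolours qg
      ... | inj₁ (new≡g , _) = inj₂ new≡g
      ... | inj₂ (_ , pg) = inj₁ pg

    matching-loses : ∀ {q} → Recolours p q c out new inF → Mᵢ G p c ∖ ｛ out ｝ ≐ Mᵢ G q c
    matching-loses {q} recolours = to , from
      where
      to : ∀ {g} → (Mᵢ G p c ∖ ｛ out ｝) g → Mᵢ G q c g
      to (pg , out≢g) with kept recolours pg
      ... | inj₁ (out≡g , _) = ⊥-elim (out≢g out≡g)
      ... | inj₂ qg = qg
      from : ∀ {g} → Mᵢ G q c g → (Mᵢ G p c ∖ ｛ out ｝) g
      from qg with gained recolours qg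
      ... | inj₂ (out≢g , pg) = pg , out≢g

    forest-kept : ∀ {q} → Recolours p q c out new inM → Fᵢ G p c ≐ Fᵢ G q c
    forest-kept {q} recolours = to , from
      where
      to : ∀ {g} → Fᵢ G p c g → Fᵢ G q c g
      to pg with kept recolours pg
      ... | inj₂ qg = qg
      from : ∀ {g} → Fᵢ G q c g → Fᵢ G p c g
      from qg with gained recolours qg
      ... | inj₂ (_ , pg) = pg

    matching-swaps : ∀ {q} → Recolours p q c out new inM → (Mᵢ G p c ∖ ｛ out ｝) ∪ ｛ new ｝ ≐ Mᵢ G q c
    matching-swaps {q} recolours = Sum.[ to , (λ { refl → new-recoloured recolours }) ] , from
      where
      to : ∀ {g} → (Mᵢ G p c ∖ ｛ out ｝) g → Mᵢ G q c g
      to (pg , out≢g) with kept recolours pg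
      ... | inj₁ (out≡g , _) = ⊥-elim (out≢g out≡g)
      ... | inj₂ qg = qg
      from : ∀ {g} → Mᵢ G q c g → ((Mᵢ G p c ∖ ｛ out ｝) ∪ ｛ new ｝) g
      from qg with gained recolours qg
      ... | inj₁ (new≡g , _) = inj₂ new≡g
      ... | inj₂ (out≢g , pg) = inj₁ (pg , out≢g)

    module _ (valid : ValidColour p c) {y x z : Vertex G} (out-yx : Joins G out y x) (new-yz : Joins G new y z) where
      private
        out∉F : ¬ Fᵢ G p c out
        out∉F pF with trans (sym pF) out∈M
        ... | ()

        new∉F : ¬ Fᵢ G p c new
        new∉F = new∉c ∘ cong proj₁

        new∉M : ¬ Mᵢ G p c new
        new∉M = new∉c ∘ cong proj₁

      forest-case : ∀ {q} → Recolours p q c out new inF → ¬ Reach G (Pᵢ G p c ∖ ｛ out ｝) y z → ValidColour q c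
      forest-case recolours separated = ValidPair-resp-≐ (forest-gains recolours) (matching-loses recolours)
        (bridge-into-forest valid out∈M out∉F new∉F new∉M out-yx new-yz separated)

      matching-case : ∀ {q} → Recolours p q c out new inM → Reach G (Pᵢ G p c ∖ ｛ out ｝) y z → ValidColour q c
      matching-case recolours closing = ValidPair-resp-≐ (forest-kept recolours) (matching-swaps recolours)
        (cycle-closer-into-matching valid out∈M out∉F new∉F new∉M out-yx new-yz closing)

      matched-endpoint-separates : ∀ {e₃ t} → Joins G e₃ z t → p e₃ ≡ (c , inM) → ¬ Reach G (Pᵢ G p c ∖ ｛ out ｝) y z
      matched-endpoint-separates = matched-endpoint-separated valid out∈M out∉F new∉F new∉M out-yx new-yz

module TwoColours (G : SimpleGraph) {k : ℕ} (p : Partition G k) (valid : Valid G p)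
  {e₁ e₂ : Edge G} {u v w : Vertex G} {i j : Fin k} (u-v : Joins G e₁ u v) (v-w : Joins G e₂ v w)
  (e₁∈Mᵢ : p e₁ ≡ (i , inM)) (e₂∈Mⱼ : p e₂ ≡ (j , inM)) (i≢j : i ≢ j) where
  open Paths G
  open Exchange G
  open Recolouring G
  open Decidability G using (Pᵢ-dec)

  q : Part G → Part G → Partition G k
  q π₁ π₂ = update₂ G p e₁ (j , π₁) e₂ (i , π₂)

  Rᵢ Rⱼ : EdgeSet G
  Rᵢ = Pᵢ G p i ∖ ｛ e₁ ｝
  Rⱼ = Pᵢ G p j ∖ ｛ e₂ ｝

  Rᵢ? : Decidable Rᵢ
  Rᵢ? = Pᵢ-dec p i ∩? ∁? (e₁ ≟_)

  Rⱼ? : Decidable Rⱼ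
  Rⱼ? = Pᵢ-dec p j ∩? ∁? (e₂ ≟_)

  private
    e₁∉j : proj₁ (p e₁) ≢ j
    e₁∉j e₁∈j = i≢j (trans (sym (cong proj₁ e₁∈Mᵢ)) e₁∈j)

    e₂∉i : proj₁ (p e₂) ≢ i
    e₂∉i e₂∈i = i≢j (trans (sym e₂∈i) (cong proj₁ e₂∈Mⱼ))

    recolours-i : ∀ π₁ π₂ → Recolours p (q π₁ π₂) i e₁ e₂ π₂
    recolours-i π₁ π₂ g with update₂-view p e₁ (j , π₁) e₂ (i , π₂) g
    ... | inj₁ (e₁≡g , qg≡jπ₁) = inj₁ (e₁≡g , λ qg∈i → i≢j (trans (sym qg∈i) (cong proj₁ qg≡jπ₁)))
    ... | inj₂ (inj₁ (_ , e₂≡g , qg≡iπ₂)) = inj₂ (inj₁ (e₂≡g , qg≡iπ₂))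
    ... | inj₂ (inj₂ unchanged) = inj₂ (inj₂ unchanged)

    recolours-j : ∀ π₁ π₂ → Recolours p (q π₁ π₂) j e₂ e₁ π₁
    recolours-j π₁ π₂ g with update₂-view p e₁ (j , π₁) e₂ (i , π₂) g
    ... | inj₁ (e₁≡g , qg≡jπ₁) = inj₂ (inj₁ (e₁≡g , qg≡jπ₁))
    ... | inj₂ (inj₁ (_ , e₂≡g , qg≡iπ₂)) = inj₁ (e₂≡g , λ qg∈j → i≢j (trans (sym (cong proj₁ qg≡iπ₂)) qg∈j))
    ... | inj₂ (inj₂ (e₁≢g , e₂≢g , qg≡pg)) = inj₂ (inj₂ (e₂≢g , e₁≢g , qg≡pg))

    other-colour : ∀ {π₁ π₂ c} → c ≢ i → c ≢ j →
      ∀ x → (λ g → p g ≡ (c , x)) ≐ (λ g → q π₁ π₂ g ≡ (c , x))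
    other-colour {π₁} {π₂} {c} c≢i c≢j x = to , from
      where
      to : ∀ {g} → p g ≡ (c , x) → q π₁ π₂ g ≡ (c , x)
      to {g} pg with update₂-view p e₁ (j , π₁) e₂ (i , π₂) g
      ... | inj₁ (refl , _) = ⊥-elim (c≢i (cong proj₁ (trans (sym pg) e₁∈Mᵢ)))
      ... | inj₂ (inj₁ (_ , refl , _)) = ⊥-elim (c≢j (cong proj₁ (trans (sym pg) e₂∈Mⱼ)))
      ... | inj₂ (inj₂ (_ , _ , qg≡pg)) = trans qg≡pg pg
      from : ∀ {g} → q π₁ π₂ g ≡ (c , x) → p g ≡ (c , x)
      from {g} qg with update₂-view p e₁ (j , π₁) e₂ (i , π₂) g
      ... | inj₁ (_ , qg≡jπ₁) = ⊥-elim (c≢j (cong proj₁ (trans (sym qg) qg≡jπ₁)))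
      ... | inj₂ (inj₁ (_ , _ , qg≡iπ₂)) = ⊥-elim (c≢i (cong proj₁ (trans (sym qg) qg≡iπ₂)))
      ... | inj₂ (inj₂ (_ , _ , qg≡pg)) = trans (sym qg≡pg) qg

  combine : ∀ {π₁ π₂} → ValidColour (q π₁ π₂) i → ValidColour (q π₁ π₂) j → Valid G (q π₁ π₂)
  combine validᵢ validⱼ c with c ≟ i
  ... | yes refl = validᵢ
  ... | no c≢i with c ≟ j
  ...   | yes refl = validⱼ
  ...   | no c≢j = ValidPair-resp-≐ (other-colour c≢i c≢j inF) (other-colour c≢i c≢j inM) (valid c)

  forestᵢ : ∀ {π₁} → ¬ Reach G Rᵢ v w → ValidColour (q π₁ inF) i
  forestᵢ {π₁} = forest-case e₁∈Mᵢ e₂∉i (valid i) (Joins-sym u-v) v-w (recolours-i π₁ inF)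

  matchingᵢ : ∀ {π₁} → Reach G Rᵢ v w → ValidColour (q π₁ inM) i
  matchingᵢ {π₁} = matching-case e₁∈Mᵢ e₂∉i (valid i) (Joins-sym u-v) v-w (recolours-i π₁ inM)

  forestⱼ : ∀ {π₂} → ¬ Reach G Rⱼ v u → ValidColour (q inF π₂) j
  forestⱼ {π₂} = forest-case e₂∈Mⱼ e₁∉j (valid j) v-w (Joins-sym u-v) (recolours-j inF π₂)

  matchingⱼ : ∀ {π₂} → Reach G Rⱼ v u → ValidColour (q inM π₂) j
  matchingⱼ {π₂} = matching-case e₂∈Mⱼ e₁∉j (valid j) v-w (Joins-sym u-v) (recolours-j inM π₂)

  separatedᵢ : ∀ {e₃ x} → Joins G e₃ w x → p e₃ ≡ (i , inM) → ¬ Reach G Rᵢ v w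
  separatedᵢ = matched-endpoint-separates e₁∈Mᵢ e₂∉i (valid i) (Joins-sym u-v) v-w

lemma7 : (G : SimpleGraph) (k : ℕ) (p : Partition G k) → Valid G p →
    (e₁ e₂ : Edge G) (u v w : Vertex G) (i j : Fin k) →
    Joins G e₁ u v → Joins G e₂ v w →
    p e₁ ≡ (i , inM) → p e₂ ≡ (j , inM) → i ≢ j →
    (Valid G (update₂ G p e₁ (j , inM) e₂ (i , inM))
      ⊎ Valid G (update₂ G p e₁ (j , inM) e₂ (i , inF))
      ⊎ Valid G (update₂ G p e₁ (j , inF) e₂ (i , inM))
      ⊎ Valid G (update₂ G p e₁ (j , inF) e₂ (i , inF)))
    × ((e₃ : Edge G) (x : Vertex G) → Joins G e₃ w x → p e₃ ≡ (i , inM) →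
        Valid G (update₂ G p e₁ (j , inM) e₂ (i , inF))
        ⊎ Valid G (update₂ G p e₁ (j , inF) e₂ (i , inF)))
lemma7 G k p valid e₁ e₂ u v w i j u-v v-w e₁∈Mᵢ e₂∈Mⱼ i≢j =
  any-option (Reach-dec Rᵢ? v w) (Reach-dec Rⱼ? v u) ,
  λ e₃ x w-x e₃∈Mᵢ → forest-option (separatedᵢ w-x e₃∈Mᵢ) (Reach-dec Rⱼ? v u)
  where
  open TwoColours G p valid u-v v-w e₁∈Mᵢ e₂∈Mⱼ i≢j
  open Decidability G using (Reach-dec)

  any-option : Dec (Reach G Rᵢ v w) → Dec (Reach G Rⱼ v u) →
    Valid G (q inM inM) ⊎ Valid G (q inM inF) ⊎ Valid G (q inF inM) ⊎ Valid G (q inF inF)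
  any-option (yes closesᵢ) (yes closesⱼ) = inj₁ (combine (matchingᵢ closesᵢ) (matchingⱼ closesⱼ))
  any-option (no separatedᵢ) (yes closesⱼ) = inj₂ (inj₁ (combine (forestᵢ separatedᵢ) (matchingⱼ closesⱼ)))
  any-option (yes closesᵢ) (no separatedⱼ) = inj₂ (inj₂ (inj₁ (combine (matchingᵢ closesᵢ) (forestⱼ separatedⱼ))))
  any-option (no separatedᵢ) (no separatedⱼ) = inj₂ (inj₂ (inj₂ (combine (forestᵢ separatedᵢ) (forestⱼ separatedⱼ))))

  forest-option : ¬ Reach G Rᵢ v w → Dec (Reach G Rⱼ v u) → Valid G (q inM inF) ⊎ Valid G (q inF inF)
  forest-option separatedᵢ (yes closesⱼ) = inj₁ (combine (forestᵢ separatedᵢ) (matchingⱼ closesⱼ))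
  forest-option separatedᵢ (no separatedⱼ) = inj₂ (combine (forestᵢ separatedᵢ) (forestⱼ separatedⱼ))
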